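{- For $n\ge 3$, let $W_n=C_n\vee K_1$ be the wheel graph on $n+1$ vertices. Then $$\chi_{\text{so}}(W_n)=\begin{cases}4, & \text{if } n\equiv 3 \pmod 6,\\ 5, & \text{if } n\equiv 0,2 \text{ or } 4 \pmod 6,\ n>8,\ n\neq 14,\\ 6, & \text{if } n\equiv 1 \text{ or } 5 \pmod 6,\ n>8,\\ 7, & \text{if } n=14,\\ n+1, & \text{if } n\le 8.\end{cases}$$
   Context: All graphs are finite and simple. A strong odd coloring of a graph $G$ is a proper vertex coloring of $G$ such that for every vertex $v$ and every color $c$, the number of neighbors of $v$ colored $c$ is either $0$ or odd. The strong odd chromatic number $\chi_{\text{so}}(G)$ is the minimum number of colors in a strong odd coloring of $G$. The join $G_1\vee G_2$ is obtained from disjoint copies of $G_1$ and $G_2$ by adding all edges between $V(G_1)$ and $V(G_2)$; $C_n$ is the cycle on $n$ vertices and $K_1$ a single vertex. -}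

module Defs where

open import Data.Nat using (ℕ; zero; suc; _+_; _<_; _%_; _≡ᵇ_)
open import Data.Fin using (Fin; toℕ; splitAt)
open import Data.List using (List; length; filterᵇ; allFin)
open import Data.Bool using (Bool; true; false; _∧_; _∨_; if_then_else_)
open import Data.Sum using (_⊎_; inj₁; inj₂)
open import Data.Product using (Σ; _×_)
open import Relation.Binary.PropositionalEquality using (_≡_; _≢_)
open import Relation.Nullary using (¬_)

record Graph : Set where
  field
    V   : ℕ
    adj : Fin V → Fin V → Bool
open Graph public

IsSimple : Graph → Set
IsSimple G = (∀ u v → adj G u v ≡ adj G v u) × (∀ v → adj G v v ≡ false)

-- The cycle C_n on vertices 0..n-1: i ~ j iff j = i+1 or i = j+1 or {i,j} = {0,n-1}.
-- (For n ≥ 3 this is the usual cycle graph.)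
cycleAdj : (n : ℕ) → ℕ → ℕ → Bool
cycleAdj n i j =
  (suc i ≡ᵇ j) ∨ (suc j ≡ᵇ i) ∨ ((i ≡ᵇ 0) ∧ (suc j ≡ᵇ n)) ∨ ((j ≡ᵇ 0) ∧ (suc i ≡ᵇ n))

Cycle : ℕ → Graph
Cycle n = record { V = n ; adj = λ i j → cycleAdj n (toℕ i) (toℕ j) }

K1 : Graph
K1 = record { V = 1 ; adj = λ _ _ → false }

joinAdj : (G₁ G₂ : Graph) → Fin (V G₁) ⊎ Fin (V G₂) → Fin (V G₁) ⊎ Fin (V G₂) → Bool
joinAdj G₁ G₂ (inj₁ u) (inj₁ v) = adj G₁ u v
joinAdj G₁ G₂ (inj₂ u) (inj₂ v) = adj G₂ u v
joinAdj G₁ G₂ (inj₁ u) (inj₂ v) = true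
joinAdj G₁ G₂ (inj₂ u) (inj₁ v) = true

Join : Graph → Graph → Graph
Join G₁ G₂ = record
  { V = V G₁ + V G₂
  ; adj = λ u v → joinAdj G₁ G₂ (splitAt (V G₁) u) (splitAt (V G₁) v) }

Wheel : ℕ → Graph
Wheel n = Join (Cycle n) K1

nbrsWithColour : (G : Graph) {k : ℕ} → (Fin (V G) → Fin k) → Fin (V G) → Fin k → ℕ
nbrsWithColour G col v c =
  length (filterᵇ (λ u → adj G v u ∧ (toℕ (col u) ≡ᵇ toℕ c)) (allFin (V G)))

Odd : ℕ → Set
Odd m = m % 2 ≡ 1

IsStrongOddColouring : (G : Graph) (k : ℕ) → (Fin (V G) → Fin k) → Set
IsStrongOddColouring G k col =
  (∀ u v → adj G u v ≡ true → col u ≢ col v)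
  × (∀ v c → nbrsWithColour G col v c ≡ 0 ⊎ Odd (nbrsWithColour G col v c))

StrongOddColourable : Graph → ℕ → Set
StrongOddColourable G k = Σ (Fin (V G) → Fin k) (IsStrongOddColouring G k)

StrongOddChromaticNumber : Graph → ℕ → Set
StrongOddChromaticNumber G k =
  StrongOddColourable G k × (∀ j → j < k → ¬ StrongOddColourable G j)

-- Colour the hub of W_n last.  A strong odd colouring of W_n with k + 1 colours is then the
-- same as a colouring of the rim C_n with k colours that is proper on the square of C_n (a rim
-- vertex sees both its cycle neighbours and the hub, and a colour seen exactly twice is not
-- allowed) and whose colour classes all have odd or zero size (the hub sees the whole rim).
--
-- Let U be the number of colours used on the rim.  Any three consecutive rim
-- vertices have distinct colours, so U ≥ 3 and every class has at most n / 3 elements; adding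
-- up the odd class sizes gives U ≡ n (mod 2); and U = 3 makes the colouring 3-periodic, which
-- forces 3 ∣ n.  For n = 14 every class has at most 3 elements, so U ≥ 5 and by parity U ≥ 6;
-- for n ≤ 8 every class is a singleton, so U = n.
--
-- Cut the rim into consecutive blocks of lengths b₁, …, b_r ≥ 3 and colour each
-- block 0, 1, …, b_j − 1.  This is proper on the square of C_n, and colour c is used once in
-- every block longer than c.  Two extra blocks of length 3 preserve all class parities, so one
-- block list per residue of n mod 6 ([3], [4,4,4], [4,4,4,4,4], [4,3,3], [5,4,4], [5,3,3]),
-- together with [6,4,4] for n = 14 and [n] for n ≤ 8, yields all the required colourings.

{-# OPTIONS --safe #-}
module Submission where

open import Data.Bool using (Bool; true; false; T; if_then_else_; _∧_; _∨_)
open import Data.Bool.Properties using (T-∨; T-∧; T-≡)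
open import Data.Empty using (⊥-elim)
open import Data.Fin using (Fin; zero; suc; toℕ; fromℕ<)
open import Data.Fin.Properties using (toℕ<n; toℕ-fromℕ<; toℕ-injective; splitAt-<; splitAt-≥)
open import Data.List using (List; []; _∷_; length; filterᵇ; tabulate)
open import Data.List.Properties using (length-map)
open import Data.List.Relation.Unary.All using (All; []; _∷_)
import Data.List.Relation.Unary.All as All
import Data.List.Relation.Unary.All.Properties as All
open import Data.List.Relation.Unary.AllPairs using (AllPairs; []; _∷_)
import Data.List.Relation.Unary.AllPairs.Properties as AllPairs
open import Data.Nat
open import Data.Nat.DivMod using (m≡m%n+[m/n]*n; [m+kn]%n≡m%n; m*n%n≡0; m%n<n; m∣n⇒o%n%m≡o%m)
open import Data.Nat.Divisibility using (_∣_; divides)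
open import Data.Nat.ListAction using (sum)
open import Data.Nat.Properties
open import Algebra.Properties.CommutativeSemigroup +-commutativeSemigroup using (interchange; x∙yz≈y∙xz)
open import Data.Product using (Σ; _×_; _,_)
open import Data.Sum using (_⊎_; inj₁; inj₂)
open import Data.Unit using (tt)
open import Function using (id; _∘_)
open import Function.Bundles using (module Equivalence)
open import Relation.Binary using (tri<; tri≈; tri>)
open import Relation.Binary.PropositionalEquality
open import Relation.Nullary using (Dec; yes; no; Reflects; ofʸ; ofⁿ; proof; map′; from-no)
open import Relation.Nullary.Decidable using (True; toWitness; _×-dec_; _⊎-dec_)

open import Defs

open Equivalence using (to; from)

⟦_⟧ : Bool → ℕ
⟦ true  ⟧ = 1
⟦ false ⟧ = 0

⟦⟧≤1 : ∀ b → ⟦ b ⟧ ≤ 1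
⟦⟧≤1 true  = ≤-refl
⟦⟧≤1 false = z≤n

≡ᵇ-reflects : ∀ m n → Reflects (m ≡ n) (m ≡ᵇ n)
≡ᵇ-reflects m n = proof (m ≟ n)

⟦≡ᵇ⟧-refl : ∀ m → ⟦ m ≡ᵇ m ⟧ ≡ 1
⟦≡ᵇ⟧-refl zero    = refl
⟦≡ᵇ⟧-refl (suc m) = ⟦≡ᵇ⟧-refl m

⟦≡ᵇ⟧-≢ : ∀ {m n} → m ≢ n → ⟦ m ≡ᵇ n ⟧ ≡ 0
⟦≡ᵇ⟧-≢ {m} {n} m≢n with m ≡ᵇ n | ≡ᵇ-reflects m n
... | true  | ofʸ m≡n = ⊥-elim (m≢n m≡n)
... | false | _       = refl

<ᵇ-true : ∀ {m n} → m < n → (m <ᵇ n) ≡ true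
<ᵇ-true {m} {n} m<n with m <ᵇ n | <ᵇ-reflects-< m n
... | true  | _         = refl
... | false | ofⁿ m≮n = ⊥-elim (m≮n m<n)

<ᵇ-false : ∀ {m n} → n ≤ m → (m <ᵇ n) ≡ false
<ᵇ-false {m} {n} n≤m with m <ᵇ n | <ᵇ-reflects-< m n
... | true  | ofʸ m<n = ⊥-elim (<⇒≱ m<n n≤m)
... | false | _        = refl

T-∨ˡ : ∀ x {y} → T x → T (x ∨ y)
T-∨ˡ true _ = tt

T-∨ʳ : ∀ x {y} → T y → T (x ∨ y)
T-∨ʳ true  _  = tt
T-∨ʳ false ty = ty

⟦T∧⟧ : ∀ {a} b → T a → ⟦ a ∧ b ⟧ ≡ ⟦ b ⟧
⟦T∧⟧ {true} b _ = refl

⟦false∧⟧ : ∀ {a} b → a ≡ false → ⟦ a ∧ b ⟧ ≡ 0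
⟦false∧⟧ b refl = refl

⟦≡ᵇ⟧-distinct₂ : ∀ {x y} c → x ≢ y → ⟦ x ≡ᵇ c ⟧ + ⟦ y ≡ᵇ c ⟧ ≤ 1
⟦≡ᵇ⟧-distinct₂ {x} {y} c x≢y with x ≡ᵇ c | ≡ᵇ-reflects x c
... | true  | ofʸ refl rewrite ⟦≡ᵇ⟧-≢ (x≢y ∘ sym) = ≤-refl
... | false | _        = ⟦⟧≤1 (y ≡ᵇ c)

⟦≡ᵇ⟧-distinct₃ : ∀ {x y z} c → x ≢ y → y ≢ z → x ≢ z → ⟦ x ≡ᵇ c ⟧ + ⟦ y ≡ᵇ c ⟧ + ⟦ z ≡ᵇ c ⟧ ≤ 1
⟦≡ᵇ⟧-distinct₃ {x} {y} {z} c x≢y y≢z x≢z with x ≡ᵇ c | ≡ᵇ-reflects x c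
... | true  | ofʸ refl rewrite ⟦≡ᵇ⟧-≢ (x≢y ∘ sym) | ⟦≡ᵇ⟧-≢ (x≢z ∘ sym) = ≤-refl
... | false | _        = ⟦≡ᵇ⟧-distinct₂ c y≢z

ZeroOrOdd : ℕ → Set
ZeroOrOdd m = m ≡ 0 ⊎ Odd m

zeroOrOdd? : ∀ m → Dec (ZeroOrOdd m)
zeroOrOdd? m = m ≟ 0 ⊎-dec m % 2 ≟ 1

≤1⇒zeroOrOdd : ∀ {m} → m ≤ 1 → ZeroOrOdd m
≤1⇒zeroOrOdd z≤n       = inj₁ refl
≤1⇒zeroOrOdd (s≤s z≤n) = inj₂ refl

zeroOrOdd-split : ∀ {m} → ZeroOrOdd m → m ≡ ⟦ 0 <ᵇ m ⟧ + m / 2 * 2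
zeroOrOdd-split {zero}  _          = refl
zeroOrOdd-split {suc m} (inj₂ odd) = trans (m≡m%n+[m/n]*n (suc m) 2) (cong (_+ suc m / 2 * 2) odd)

zeroOrOdd-≤ : ∀ {x} m → ZeroOrOdd x → x < 3 + m * 2 → x ≤ ⟦ 0 <ᵇ x ⟧ * (1 + m * 2)
zeroOrOdd-≤ {zero}  m _          _ = z≤n
zeroOrOdd-≤ {suc x} m (inj₂ odd) x<3+2m =
  subst (suc x ≤_) (sym (*-identityˡ _)) (s≤s⁻¹ (≤∧≢⇒< (s≤s⁻¹ x<3+2m) x≢2+2m))
  where
  x≢2+2m : suc x ≢ suc m * 2
  x≢2+2m x≡2+2m with trans (sym odd) (trans (cong (_% 2) x≡2+2m) (m*n%n≡0 (suc m) 2))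
  ... | ()

parity-step : ∀ {m u} → m ≤ u → u % 2 ≢ m % 2 → suc m ≤ u
parity-step m≤u parities≢ = ≤∧≢⇒< m≤u (λ m≡u → parities≢ (cong (_% 2) (sym m≡u)))

-- Finite sums over ℕ

∑< : ℕ → (ℕ → ℕ) → ℕ
∑< zero    f = 0
∑< (suc m) f = f 0 + ∑< m (f ∘ suc)

syntax ∑< m (λ i → e) = ∑[ i < m ] e

∑-cong : ∀ m {f g : ℕ → ℕ} → (∀ {i} → i < m → f i ≡ g i) → ∑< m f ≡ ∑< m g
∑-cong zero    f≗g = refl
∑-cong (suc m) f≗g = cong₂ _+_ (f≗g z<s) (∑-cong m (f≗g ∘ s<s))

∑-mono-≤ : ∀ m {f g : ℕ → ℕ} → (∀ {i} → i < m → f i ≤ g i) → ∑< m f ≤ ∑< m g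
∑-mono-≤ zero    f≤g = z≤n
∑-mono-≤ (suc m) f≤g = +-mono-≤ (f≤g z<s) (∑-mono-≤ m (f≤g ∘ s<s))

∑-mono-< : ∀ m {f g : ℕ → ℕ} → (∀ {i} → i < m → f i ≤ g i) →
           ∀ {a} → a < m → f a < g a → ∑< m f < ∑< m g
∑-mono-< (suc m) f≤g {zero}  _ fa<ga = +-mono-<-≤ fa<ga (∑-mono-≤ m (f≤g ∘ s<s))
∑-mono-< (suc m) f≤g {suc a} a<m fa<ga =
  +-mono-≤-< (f≤g z<s) (∑-mono-< m (f≤g ∘ s<s) (s<s⁻¹ a<m) fa<ga)

∑-zero : ∀ m {f : ℕ → ℕ} → (∀ {i} → i < m → f i ≡ 0) → ∑< m f ≡ 0
∑-zero zero    f≗0 = refl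
∑-zero (suc m) f≗0 = cong₂ _+_ (f≗0 z<s) (∑-zero m (f≗0 ∘ s<s))

∑-one : ∀ m → ∑[ i < m ] 1 ≡ m
∑-one zero    = refl
∑-one (suc m) = cong suc (∑-one m)

∑-distrib-+ : ∀ m (f g : ℕ → ℕ) → ∑[ i < m ] (f i + g i) ≡ ∑< m f + ∑< m g
∑-distrib-+ zero    f g = refl
∑-distrib-+ (suc m) f g = begin
  (f 0 + g 0) + ∑[ i < m ] (f (suc i) + g (suc i)) ≡⟨ cong ((f 0 + g 0) +_) (∑-distrib-+ m (f ∘ suc) (g ∘ suc)) ⟩
  (f 0 + g 0) + (∑< m (f ∘ suc) + ∑< m (g ∘ suc))  ≡⟨ interchange (f 0) (g 0) _ _ ⟩
  (f 0 + ∑< m (f ∘ suc)) + (g 0 + ∑< m (g ∘ suc))  ∎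
  where open ≡-Reasoning

∑-*ʳ : ∀ m (f : ℕ → ℕ) a → ∑[ i < m ] (f i * a) ≡ ∑< m f * a
∑-*ʳ zero    f a = refl
∑-*ʳ (suc m) f a = trans (cong (f 0 * a +_) (∑-*ʳ m (f ∘ suc) a)) (sym (*-distribʳ-+ a (f 0) _))

∑-+ : ∀ m n (f : ℕ → ℕ) → ∑< (m + n) f ≡ ∑< m f + ∑[ i < n ] f (m + i)
∑-+ zero    n f = refl
∑-+ (suc m) n f = trans (cong (f 0 +_) (∑-+ m n (f ∘ suc))) (sym (+-assoc (f 0) _ _))

∑-snoc : ∀ m (f : ℕ → ℕ) → ∑< (suc m) f ≡ ∑< m f + f m
∑-snoc zero    f = +-identityʳ (f 0)
∑-snoc (suc m) f = trans (cong (f 0 +_) (∑-snoc m (f ∘ suc))) (sym (+-assoc (f 0) _ _))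

∑-comm : ∀ m n (f : ℕ → ℕ → ℕ) → ∑[ i < m ] ∑[ j < n ] f i j ≡ ∑[ j < n ] ∑[ i < m ] f i j
∑-comm zero    n f = sym (∑-zero n (λ _ → refl))
∑-comm (suc m) n f = trans (cong (∑< n (f 0) +_) (∑-comm m n (f ∘ suc)))
                           (sym (∑-distrib-+ n (f 0) (λ j → ∑[ i < m ] f (suc i) j)))

∑-indicatorˡ : ∀ m c → ∑[ i < m ] ⟦ i ≡ᵇ c ⟧ ≡ ⟦ c <ᵇ m ⟧
∑-indicatorˡ zero    c       = refl
∑-indicatorˡ (suc m) zero    = cong suc (∑-zero m (λ _ → refl))
∑-indicatorˡ (suc m) (suc c) = ∑-indicatorˡ m c

∑-indicatorʳ : ∀ m c → ∑[ i < m ] ⟦ c ≡ᵇ i ⟧ ≡ ⟦ c <ᵇ m ⟧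
∑-indicatorʳ zero    c       = refl
∑-indicatorʳ (suc m) zero    = cong suc (∑-zero m (λ _ → refl))
∑-indicatorʳ (suc m) (suc c) = ∑-indicatorʳ m c

_∖_ : (ℕ → ℕ) → ℕ → ℕ → ℕ
(f ∖ a) i = if i ≡ᵇ a then 0 else f i

∖-≢ : ∀ (f : ℕ → ℕ) {a i} → i ≢ a → (f ∖ a) i ≡ f i
∖-≢ f {a} {i} i≢a with i ≡ᵇ a | ≡ᵇ-reflects i a
... | true  | ofʸ i≡a = ⊥-elim (i≢a i≡a)
... | false | _       = refl

∑-pick : ∀ m (f : ℕ → ℕ) {a} → a < m → ∑< m f ≡ f a + ∑< m (f ∖ a)
∑-pick (suc m) f {zero}  _   = refl
∑-pick (suc m) f {suc a} a<m =
  trans (cong (f 0 +_) (∑-pick m (f ∘ suc) (s<s⁻¹ a<m))) (x∙yz≈y∙xz (f 0) (f (suc a)) _)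

∑-≥-term : ∀ m (f : ℕ → ℕ) {a} → a < m → f a ≤ ∑< m f
∑-≥-term m f a<m = subst (f _ ≤_) (sym (∑-pick m f a<m)) (m≤m+n _ _)

length≤∑ : ∀ m (f : ℕ → ℕ) {xs : List ℕ} → All (_< m) xs → All (λ x → 0 < f x) xs →
           AllPairs _≢_ xs → length xs ≤ ∑< m f
length≤∑ m f []                  []               []                = z≤n
length≤∑ m f {x ∷ xs} (x<m ∷ xs<m) (0<fx ∷ 0<fxs) (x∉xs ∷ distinct) = begin
  suc (length xs)             ≤⟨ +-mono-≤ 0<fx (length≤∑ m (f ∖ x) xs<m 0<fxs′ distinct) ⟩
  f x + ∑< m (f ∖ x)          ≡⟨ ∑-pick m f x<m ⟨
  ∑< m f                      ∎
  where
  open ≤-Reasoning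
  0<fxs′ = All.zipWith (λ (x≢y , 0<fy) → subst (0 <_) (sym (∖-≢ f (x≢y ∘ sym))) 0<fy) (x∉xs , 0<fxs)

∑-pair : ∀ m (f : ℕ → ℕ) {a b} → a < m → b < m → a ≢ b →
         (∀ {i} → i < m → i ≢ a → i ≢ b → f i ≡ 0) → ∑< m f ≡ f a + f b
∑-pair m f {a} {b} a<m b<m a≢b f≡0 = begin
  ∑< m f                                    ≡⟨ ∑-pick m f a<m ⟩
  f a + ∑< m (f ∖ a)                        ≡⟨ cong (f a +_) (∑-pick m (f ∖ a) b<m) ⟩
  f a + ((f ∖ a) b + ∑< m ((f ∖ a) ∖ b))     ≡⟨ cong₂ (λ x y → f a + (x + y)) (∖-≢ f (a≢b ∘ sym)) (∑-zero m rest≡0) ⟩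
  f a + (f b + 0)                           ≡⟨ cong (f a +_) (+-identityʳ (f b)) ⟩
  f a + f b                                 ∎
  where
  open ≡-Reasoning
  rest≡0 : ∀ {i} → i < m → ((f ∖ a) ∖ b) i ≡ 0
  rest≡0 {i} i<m with i ≡ᵇ b | ≡ᵇ-reflects i b
  ... | true  | _       = refl
  ... | false | ofⁿ i≢b with i ≡ᵇ a | ≡ᵇ-reflects i a
  ...   | true  | _       = refl
  ...   | false | ofⁿ i≢a = f≡0 i<m i≢a i≢b

-- The cycle C_n

next : ℕ → ℕ → ℕ
next n i = if suc i ≡ᵇ n then 0 else suc i

prev : ℕ → ℕ → ℕ
prev n zero    = pred n
prev n (suc i) = i

next-suc : ∀ {n i} → suc i < n → next n i ≡ suc i
next-suc {n} {i} 1+i<n with suc i ≡ᵇ n | ≡ᵇ-reflects (suc i) n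
... | true  | ofʸ refl = ⊥-elim (<-irrefl refl 1+i<n)
... | false | _        = refl

next-last : ∀ {n i} → suc i ≡ n → next n i ≡ 0
next-last {n} {i} 1+i≡n with suc i ≡ᵇ n | ≡ᵇ-reflects (suc i) n
... | true  | _          = refl
... | false | ofⁿ 1+i≢n = ⊥-elim (1+i≢n 1+i≡n)

next<n : ∀ {n i} → i < n → next n i < n
next<n {n} {i} i<n with suc i ≡ᵇ n | ≡ᵇ-reflects (suc i) n
... | true  | _          = <-≤-trans z<s i<n
... | false | ofⁿ 1+i≢n = ≤∧≢⇒< i<n 1+i≢n

prev<n : ∀ {n i} → i < n → prev n i < n
prev<n {suc n} {zero}  _   = n<1+n n
prev<n {n}     {suc i} i<n = <-trans (n<1+n i) i<n

prev-next : ∀ {n i} → i < n → prev n (next n i) ≡ i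
prev-next {n} {i} i<n with suc i ≡ᵇ n | ≡ᵇ-reflects (suc i) n
... | true  | ofʸ refl = refl
... | false | _        = refl

next-prev : ∀ {n i} → i < n → next n (prev n i) ≡ i
next-prev {suc n} {zero}  _   = next-last refl
next-prev {n}     {suc i} i<n = next-suc i<n

prev≢next : ∀ {n i} → 3 ≤ n → i < n → prev n i ≢ next n i
prev≢next {i = zero} (s≤s (s≤s (s≤s _))) _ ()
prev≢next {n} {suc i} 3≤n _ with suc (suc i) ≡ᵇ n | ≡ᵇ-reflects (suc (suc i)) n
prev≢next {_} {suc (suc i)} _ _             | true  | ofʸ refl = λ ()
prev≢next {_} {suc zero}    (s≤s (s≤s ())) _ | true  | ofʸ refl
... | false | _ = λ i≡2+i → <-irrefl i≡2+i (m<n⇒m<1+n (n<1+n i))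

next-wrap : ∀ {n i} (F : ℕ → ℕ) → F n ≡ F 0 → i < n → F (next n i) ≡ F (suc i)
next-wrap {n} {i} F Fn≡F0 i<n with suc i ≡ᵇ n | ≡ᵇ-reflects (suc i) n
... | true  | ofʸ refl = sym Fn≡F0
... | false | _        = refl

cycleAdj-next : ∀ {n i} → i < n → T (cycleAdj n i (next n i))
cycleAdj-next {n} {i} i<n with suc i ≡ᵇ n | ≡ᵇ-reflects (suc i) n
... | true  | ofʸ refl = T-∨ʳ (1 ≡ᵇ i) (T-∨ʳ ((i ≡ᵇ 0) ∧ (1 ≡ᵇ suc i)) tt)
... | false | _        = T-∨ˡ (i ≡ᵇ i) (≡⇒≡ᵇ i i refl)

cycleAdj-prev : ∀ {n i} → i < n → T (cycleAdj n i (prev n i))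
cycleAdj-prev {suc n} {zero}  _ = T-∨ʳ (1 ≡ᵇ n) (T-∨ˡ (n ≡ᵇ n) (≡⇒≡ᵇ n n refl))
cycleAdj-prev {n}     {suc i} _ = T-∨ʳ (suc (suc i) ≡ᵇ i) (T-∨ˡ (i ≡ᵇ i) (≡⇒≡ᵇ i i refl))

cycleAdj⇒ : ∀ {n i j} → j < n → T (cycleAdj n i j) → j ≡ next n i ⊎ j ≡ prev n i
cycleAdj⇒ {n} {i} {j} j<n adj with to T-∨ adj
... | inj₁ i+1=j with ≡ᵇ⇒≡ (suc i) j i+1=j
...   | refl = inj₁ (sym (next-suc j<n))
cycleAdj⇒ {n} {i} {j} j<n adj | inj₂ adj′ with to T-∨ adj′
... | inj₁ j+1=i with ≡ᵇ⇒≡ (suc j) i j+1=i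
...   | refl = inj₂ refl
cycleAdj⇒ {n} {i} {j} j<n adj | inj₂ adj′ | inj₂ adj″ with to T-∨ adj″
... | inj₁ first with to T-∧ first
...   | i=0 , j+1=n with ≡ᵇ⇒≡ i 0 i=0 | ≡ᵇ⇒≡ (suc j) n j+1=n
...     | refl | refl = inj₂ refl
cycleAdj⇒ {n} {i} {j} j<n adj | inj₂ adj′ | inj₂ adj″ | inj₂ last with to T-∧ last
...   | j=0 , i+1=n with ≡ᵇ⇒≡ j 0 j=0 | ≡ᵇ⇒≡ (suc i) n i+1=n
...     | refl | refl = inj₁ (sym (next-last refl))

∑-rotate : ∀ n (f : ℕ → ℕ) → ∑[ i < n ] f (next n i) ≡ ∑< n f
∑-rotate zero    f = refl
∑-rotate (suc n) f = begin
  ∑[ i < suc n ] f (next (suc n) i)                  ≡⟨ ∑-snoc n (f ∘ next (suc n)) ⟩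
  ∑[ i < n ] f (next (suc n) i) + f (next (suc n) n) ≡⟨ cong₂ _+_ (∑-cong n (cong f ∘ next-suc ∘ s<s)) (cong f (next-last refl)) ⟩
  ∑[ i < n ] f (suc i) + f 0                         ≡⟨ +-comm _ (f 0) ⟩
  ∑< (suc n) f                                       ∎
  where open ≡-Reasoning

∑-window-bound : ∀ n (f : ℕ → ℕ) → (∀ {i} → i < n → f i + f (next n i) + f (next n (next n i)) ≤ 1) →
                 3 * ∑< n f ≤ n
∑-window-bound n f window≤1 = begin
  3 * S                                                   ≡⟨ cong (λ x → S + (S + x)) (+-identityʳ S) ⟩
  S + (S + S)                                             ≡⟨ +-assoc S S S ⟨
  S + S + S                                               ≡⟨ cong₂ (λ x y → S + x + y) (∑-rotate n f) (trans (∑-rotate n (f ∘ next n)) (∑-rotate n f)) ⟨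
  S + ∑< n (f ∘ next n) + S″                              ≡⟨ cong (_+ S″) (∑-distrib-+ n f (f ∘ next n)) ⟨
  ∑[ i < n ] (f i + f (next n i)) + S″                    ≡⟨ ∑-distrib-+ n _ _ ⟨
  ∑[ i < n ] (f i + f (next n i) + f (next n (next n i))) ≤⟨ ∑-mono-≤ n window≤1 ⟩
  ∑[ i < n ] 1                                            ≡⟨ ∑-one n ⟩
  n                                                       ∎
  where
  open ≤-Reasoning
  S S″ : ℕ
  S  = ∑< n f
  S″ = ∑< n (f ∘ next n ∘ next n)

-- Rim colourings and lower bounds

classSize : ℕ → (ℕ → ℕ) → ℕ → ℕ
classSize n F c = ∑[ i < n ] ⟦ F i ≡ᵇ c ⟧

record RimColouring (n k : ℕ) (F : ℕ → ℕ) : Set where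
  field
    bounded    : ∀ {i} → i < n → F i < k
    proper     : ∀ {i} → i < n → F i ≢ F (next n i)
    proper²    : ∀ {i} → i < n → F (prev n i) ≢ F (next n i)
    oddClasses : ∀ {c} → c < k → ZeroOrOdd (classSize n F c)

usedColours : ℕ → ℕ → (ℕ → ℕ) → ℕ
usedColours n k F = ∑[ c < k ] ⟦ 0 <ᵇ classSize n F c ⟧

module _ {n k F} (R : RimColouring n k F) where
  open RimColouring R

  cycle-neighbours-≢ : ∀ {a b} → a < n → b < n → T (cycleAdj n a b) → F a ≢ F b
  cycle-neighbours-≢ a<n b<n ab with cycleAdj⇒ b<n ab
  ... | inj₁ refl = proper a<n
  ... | inj₂ refl = λ same → proper (prev<n a<n) (trans (sym same) (cong F (sym (next-prev a<n))))

  unused-beyond : ∀ {c} → k ≤ c → classSize n F c ≡ 0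
  unused-beyond k≤c = ∑-zero n (λ i<n → ⟦≡ᵇ⟧-≢ (<⇒≢ (<-≤-trans (bounded i<n) k≤c)))

module UsedColours {n k F} (3≤n : 3 ≤ n) (R : RimColouring n k F) where
  open RimColouring R

  private
    U : ℕ
    U = usedColours n k F

  ∑-classSize : ∑[ c < k ] classSize n F c ≡ n
  ∑-classSize = begin
    ∑[ c < k ] ∑[ i < n ] ⟦ F i ≡ᵇ c ⟧ ≡⟨ ∑-comm k n (λ c i → ⟦ F i ≡ᵇ c ⟧) ⟩
    ∑[ i < n ] ∑[ c < k ] ⟦ F i ≡ᵇ c ⟧ ≡⟨ ∑-cong n (λ i<n → trans (∑-indicatorʳ k (F _)) (cong ⟦_⟧ (<ᵇ-true (bounded i<n)))) ⟩
    ∑[ i < n ] 1                       ≡⟨ ∑-one n ⟩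
    n                                  ∎
    where open ≡-Reasoning

  classSize-positive : ∀ {i} → i < n → 0 < classSize n F (F i)
  classSize-positive {i} i<n = subst (_≤ classSize n F (F i)) (⟦≡ᵇ⟧-refl (F i)) (∑-≥-term n (λ j → ⟦ F j ≡ᵇ F i ⟧) i<n)

  distinct≤used : ∀ ps → All (_< n) ps → AllPairs (λ p q → F p ≢ F q) ps → length ps ≤ U
  distinct≤used ps ps<n distinct =
    subst (_≤ U) (length-map F ps)
      (length≤∑ k _ (All.map⁺ (All.map bounded ps<n)) (All.map⁺ (All.map used ps<n)) (AllPairs.map⁺ distinct))
    where
    used : ∀ {i} → i < n → 0 < ⟦ 0 <ᵇ classSize n F (F i) ⟧
    used i<n rewrite <ᵇ-true (classSize-positive i<n) = z<s

  ≢-suc : ∀ {j} → suc j < n → F j ≢ F (suc j)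
  ≢-suc 1+j<n = subst (λ x → F _ ≢ F x) (next-suc 1+j<n) (proper (<-trans (n<1+n _) 1+j<n))

  ≢-suc² : ∀ {j} → suc (suc j) < n → F j ≢ F (suc (suc j))
  ≢-suc² 2+j<n = subst (λ x → F _ ≢ F x) (next-suc 2+j<n) (proper² (<-trans (n<1+n _) 2+j<n))

  3≤used : 3 ≤ U
  3≤used = distinct≤used (0 ∷ 1 ∷ 2 ∷ []) (0<n ∷ 1<n ∷ 3≤n ∷ [])
             ((≢-suc 1<n ∷ ≢-suc² 3≤n ∷ []) ∷ (≢-suc 3≤n ∷ []) ∷ [] ∷ [])
    where
    1<n = <-trans (n<1+n 1) 3≤n
    0<n = <-trans z<s 1<n

  used-parity : U % 2 ≡ n % 2
  used-parity = sym (trans (cong (_% 2) n≡U+2H) ([m+kn]%n≡m%n U (∑[ c < k ] (classSize n F c / 2)) 2))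
    where
    open ≡-Reasoning
    n≡U+2H : n ≡ U + ∑[ c < k ] (classSize n F c / 2) * 2
    n≡U+2H = begin
      n                                                                ≡⟨ ∑-classSize ⟨
      ∑[ c < k ] classSize n F c                                       ≡⟨ ∑-cong k (zeroOrOdd-split ∘ oddClasses) ⟩
      ∑[ c < k ] (⟦ 0 <ᵇ classSize n F c ⟧ + classSize n F c / 2 * 2) ≡⟨ ∑-distrib-+ k _ _ ⟩
      U + ∑[ c < k ] (classSize n F c / 2 * 2)                         ≡⟨ cong (U +_) (∑-*ʳ k _ 2) ⟩
      U + ∑[ c < k ] (classSize n F c / 2) * 2                         ∎

  3*classSize≤n : ∀ c → 3 * classSize n F c ≤ n
  3*classSize≤n c = ∑-window-bound n (λ i → ⟦ F i ≡ᵇ c ⟧) λ i<n →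
    ⟦≡ᵇ⟧-distinct₃ c (proper i<n) (proper (next<n i<n))
      (λ same → proper² (next<n i<n) (trans (cong F (prev-next i<n)) same))

  n≤used*[1+2m] : ∀ m → n < 3 * (3 + m * 2) → n ≤ U * (1 + m * 2)
  n≤used*[1+2m] m n<3[3+2m] = begin
    n                                                   ≡⟨ ∑-classSize ⟨
    ∑[ c < k ] classSize n F c                          ≤⟨ ∑-mono-≤ k (λ c<k → zeroOrOdd-≤ m (oddClasses c<k) (classSize<3+2m _)) ⟩
    ∑[ c < k ] (⟦ 0 <ᵇ classSize n F c ⟧ * (1 + m * 2)) ≡⟨ ∑-*ʳ k _ _ ⟩
    U * (1 + m * 2)                                     ∎
    where
    open ≤-Reasoning
    classSize<3+2m : ∀ c → classSize n F c < 3 + m * 2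
    classSize<3+2m c = *-cancelˡ-< 3 _ _ (≤-<-trans (3*classSize≤n c) n<3[3+2m])

  used≡3⇒3∣n : U ≡ 3 → n % 3 ≡ 0
  -- With three colours, F (3 + j) ≢ F j would put four colours on j, …, 3 + j; so F is
  -- 3-periodic, and then the edges closing up the cycle clash unless 3 ∣ n.
  used≡3⇒3∣n U≡3 = remainder≡0 (n % 3) (m%n<n n 3) (trans (m≡m%n+[m/n]*n n 3) (+-comm (n % 3) _))
    where
    period : ∀ {j} → 3 + j < n → F (3 + j) ≡ F j
    period {j} 3+j<n with F (3 + j) ≟ F j
    ... | yes same = same
    ... | no  differ = ⊥-elim (<-irrefl refl (subst (4 ≤_) U≡3
            (distinct≤used (j ∷ 1 + j ∷ 2 + j ∷ 3 + j ∷ []) (j<n ∷ 1+j<n ∷ 2+j<n ∷ 3+j<n ∷ [])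
              ((≢-suc 1+j<n ∷ ≢-suc² 2+j<n ∷ differ ∘ sym ∷ []) ∷ (≢-suc 2+j<n ∷ ≢-suc² 3+j<n ∷ [])
                ∷ (≢-suc 3+j<n ∷ []) ∷ [] ∷ []))))
      where
      2+j<n = <-trans (n<1+n _) 3+j<n
      1+j<n = <-trans (n<1+n _) 2+j<n
      j<n   = <-trans (n<1+n _) 1+j<n

    periodic : ∀ q {r} → q * 3 + r < n → F (q * 3 + r) ≡ F r
    periodic zero    _  = refl
    periodic (suc q) lt = trans (period lt) (periodic q (≤-<-trans (m≤n+m _ 3) lt))

    remainder≡0 : ∀ r → r < 3 → n ≡ n / 3 * 3 + r → r ≡ 0
    remainder≡0 0 _ _ = refl
    remainder≡0 1 _ n≡3q+1 = ⊥-elim (proper p<n (trans (periodic (n / 3) p<n) (cong F (sym (next-last 1+p≡n)))))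
      where
      p = n / 3 * 3 + 0
      1+p≡n = trans (sym (+-suc _ 0)) (sym n≡3q+1)
      p<n = subst (p <_) 1+p≡n (n<1+n p)
    remainder≡0 2 _ n≡3q+2 = ⊥-elim (proper² 1+p<n (trans (periodic (n / 3) p<n) (cong F (sym (next-last 2+p≡n)))))
      where
      p = n / 3 * 3 + 0
      2+p≡n = trans (sym (trans (+-suc _ 1) (cong suc (+-suc _ 0)))) (sym n≡3q+2)
      1+p<n = subst (suc p <_) 2+p≡n (n<1+n (suc p))
      p<n = <-trans (n<1+n p) 1+p<n
    remainder≡0 (suc (suc (suc _))) (s≤s (s≤s (s≤s ()))) _

  even⇒4≤used : n % 2 ≡ 0 → 4 ≤ U
  even⇒4≤used n-even = parity-step 3≤used λ U-odd → 0≢1+n (trans (sym n-even) (trans (sym used-parity) U-odd))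

  odd⇒5≤used : n % 2 ≡ 1 → n % 3 ≢ 0 → 5 ≤ U
  odd⇒5≤used n-odd 3∤n = parity-step (≤∧≢⇒< 3≤used (3∤n ∘ used≡3⇒3∣n ∘ sym))
    λ U-even → 1+n≢0 (trans (sym n-odd) (trans (sym used-parity) U-even))

  14⇒6≤used : n ≡ 14 → 6 ≤ U
  14⇒6≤used n≡14 = parity-step 5≤U λ U-odd → 0≢1+n (trans (sym (cong (_% 2) n≡14)) (trans (sym used-parity) U-odd))
    where
    14≤3U : 14 ≤ U * 3
    14≤3U = subst (_≤ U * 3) n≡14 (n≤used*[1+2m] 1 (subst (_< 15) (sym n≡14) ≤-refl))
    5≤U : 5 ≤ U
    5≤U = *-cancelʳ-< 3 4 U (<-≤-trans (m<m+n 12 z<s) 14≤3U)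

  ≤8⇒n≤used : n ≤ 8 → n ≤ U
  ≤8⇒n≤used n≤8 = subst (n ≤_) (*-identityʳ U) (n≤used*[1+2m] 0 (s≤s n≤8))

-- Block colourings

Step : ℕ → ℕ → Set
Step x y = y ≡ suc x ⊎ (y ≡ 0 × 2 ≤ x)

step-≢ : ∀ {x y} → Step x y → x ≢ y
step-≢ (inj₁ refl)        = 1+n≢n ∘ sym
step-≢ (inj₂ (refl , ())) refl

step-step-≢ : ∀ {x y z} → Step x y → Step y z → x ≢ z
step-step-≢ {x} (inj₁ refl) (inj₁ refl) x≡2+x = <-irrefl x≡2+x (m<n⇒m<1+n (n<1+n x))
step-step-≢ (inj₁ refl)              (inj₂ (refl , s≤s ())) refl
step-step-≢ (inj₂ (refl , s≤s ()))   (inj₁ refl)            refl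
step-step-≢ (inj₂ (refl , _))        (inj₂ (_ , ()))

blockColouring : List ℕ → ℕ → ℕ
blockColouring []       i = 0
blockColouring (b ∷ bs) i = if i <ᵇ b then i else blockColouring bs (i ∸ b)

longerThan : ℕ → List ℕ → ℕ
longerThan c []       = 0
longerThan c (b ∷ bs) = ⟦ c <ᵇ b ⟧ + longerThan c bs

module _ (b : ℕ) (bs : List ℕ) where

  block-inside : ∀ {i} → i < b → blockColouring (b ∷ bs) i ≡ i
  block-inside i<b rewrite <ᵇ-true i<b = refl

  block-boundary : blockColouring (b ∷ bs) b ≡ blockColouring bs 0
  block-boundary rewrite <ᵇ-false (≤-refl {b}) | n∸n≡0 b = refl

  block-after : ∀ j → blockColouring (b ∷ bs) (b + j) ≡ blockColouring bs j
  block-after j rewrite <ᵇ-false (m≤m+n b j) | m+n∸m≡n b j = refl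

block-start : ∀ {bs} → All (3 ≤_) bs → blockColouring bs 0 ≡ 0
block-start []          = refl
block-start (s≤s _ ∷ _) = refl

block-end : ∀ bs → blockColouring bs (sum bs) ≡ 0
block-end []       = refl
block-end (b ∷ bs) = trans (block-after b bs (sum bs)) (block-end bs)

block-step : ∀ {bs i} → All (3 ≤_) bs → i < sum bs → Step (blockColouring bs i) (blockColouring bs (suc i))
block-step {b ∷ bs} {i} (3≤b ∷ long) i<sum with <-cmp (suc i) b
... | tri< 1+i<b _ _
  rewrite block-inside b bs 1+i<b | block-inside b bs (<-trans (n<1+n i) 1+i<b) = inj₁ refl
... | tri≈ _ refl _
  rewrite block-inside b bs (n<1+n i) | block-boundary (suc i) bs | block-start long = inj₂ (refl , s≤s⁻¹ 3≤b)
... | tri> _ _ b<1+i with m≤n⇒∃[o]m+o≡n (s≤s⁻¹ b<1+i)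
...   | j , refl = subst₂ Step (sym (block-after b bs j)) (sym (trans (cong F (sym (+-suc b j))) (block-after b bs (suc j))))
                          (block-step long (+-cancelˡ-< b _ _ i<sum))
  where F = blockColouring (b ∷ bs)

block-bounded : ∀ {k bs i} → All (_≤ k) bs → i < sum bs → blockColouring bs i < k
block-bounded {bs = b ∷ bs} {i} (b≤k ∷ short) i<sum with i <? b
... | yes i<b rewrite block-inside b bs i<b = <-≤-trans i<b b≤k
... | no  i≮b with m≤n⇒∃[o]m+o≡n (≮⇒≥ i≮b)
...   | j , refl = subst (_< _) (sym (block-after b bs j)) (block-bounded short (+-cancelˡ-< b _ _ i<sum))

block-classSize : ∀ bs c → classSize (sum bs) (blockColouring bs) c ≡ longerThan c bs
block-classSize []       c = refl
block-classSize (b ∷ bs) c = begin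
  classSize (b + sum bs) F c                                  ≡⟨ ∑-+ b (sum bs) _ ⟩
  ∑[ i < b ] ⟦ F i ≡ᵇ c ⟧ + ∑[ i < sum bs ] ⟦ F (b + i) ≡ᵇ c ⟧
    ≡⟨ cong₂ _+_ (∑-cong b (cong (λ x → ⟦ x ≡ᵇ c ⟧) ∘ block-inside b bs))
                 (∑-cong (sum bs) (λ {i} _ → cong (λ x → ⟦ x ≡ᵇ c ⟧) (block-after b bs i))) ⟩
  ∑[ i < b ] ⟦ i ≡ᵇ c ⟧ + classSize (sum bs) (blockColouring bs) c ≡⟨ cong₂ _+_ (∑-indicatorˡ b c) (block-classSize bs c) ⟩
  ⟦ c <ᵇ b ⟧ + longerThan c bs                                ∎
  where
  open ≡-Reasoning
  F = blockColouring (b ∷ bs)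

record BlockPartition (k : ℕ) (bs : List ℕ) : Set where
  field
    blocks≥3  : All (3 ≤_) bs
    blocks≤k  : All (_≤ k) bs
    oddLength : Odd (length bs)
    oddLonger : ∀ {c} → c < k → ZeroOrOdd (longerThan c bs)

blockPartition? : ∀ k bs → Dec (BlockPartition k bs)
blockPartition? k bs =
  map′ (λ (p , q , r , s) → record { blocks≥3 = p ; blocks≤k = q ; oddLength = r ; oddLonger = λ {c} → s {c} })
       (λ P → let open BlockPartition P in blocks≥3 , blocks≤k , oddLength , λ {c} → oddLonger {c})
       (All.all? (3 ≤?_) bs ×-dec All.all? (_≤? k) bs ×-dec length bs % 2 ≟ 1
          ×-dec allUpTo? (λ c → zeroOrOdd? (longerThan c bs)) k)

decidePartition : ∀ k bs → {True (blockPartition? k bs)} → BlockPartition k bs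
decidePartition k bs {p} = toWitness p

blockRimColouring : ∀ {k bs} → BlockPartition k bs → RimColouring (sum bs) k (blockColouring bs)
blockRimColouring {k} {bs} P = record
  { bounded   = block-bounded blocks≤k
  ; proper    = step-≢ ∘ cyclic-step
  ; proper²   = λ i<n → step-step-≢ (subst (Step _) (cong F (next-prev i<n)) (cyclic-step (prev<n i<n))) (cyclic-step i<n)
  ; oddClasses = λ {c} c<k → subst ZeroOrOdd (sym (block-classSize bs c)) (oddLonger c<k)
  }
  where
  open BlockPartition P
  F = blockColouring bs
  n = sum bs
  -- Past its last block the colouring is 0 = F 0, so the step out of the last block wraps around.
  cyclic-step : ∀ {i} → i < n → Step (F i) (F (next n i))
  cyclic-step i<n = subst (Step _) (sym (next-wrap F (trans (block-end bs) (sym (block-start blocks≥3))) i<n))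
                          (block-step blocks≥3 i<n)

longerThan-short : ∀ {bs c} → All (3 ≤_) bs → c < 3 → longerThan c bs ≡ length bs
longerThan-short []           c<3 = refl
longerThan-short (3≤b ∷ long) c<3 rewrite <ᵇ-true (<-≤-trans c<3 3≤b) = cong suc (longerThan-short long c<3)

partition-3≤k : ∀ {k bs} → BlockPartition k bs → 3 ≤ k
partition-3≤k {bs = []} P with BlockPartition.oddLength P
... | ()
partition-3≤k {bs = b ∷ bs} P with BlockPartition.blocks≥3 P | BlockPartition.blocks≤k P
... | 3≤b ∷ _ | b≤k ∷ _ = ≤-trans 3≤b b≤k

pad : ℕ → List ℕ → List ℕ
pad zero    bs = bs
pad (suc s) bs = 3 ∷ 3 ∷ pad s bs

sum-pad : ∀ s bs → sum (pad s bs) ≡ sum bs + s * 6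
sum-pad zero    bs = sym (+-identityʳ (sum bs))
sum-pad (suc s) bs = trans (cong (6 +_) (sum-pad s bs)) (x∙yz≈y∙xz 6 (sum bs) (s * 6))

pad-partition : ∀ {k bs} s → BlockPartition k bs → BlockPartition k (pad s bs)
pad-partition zero    P = P
pad-partition {k} {bs} (suc s) P = record
  { blocks≥3  = ≤-refl ∷ ≤-refl ∷ blocks≥3
  ; blocks≤k  = 3≤k ∷ 3≤k ∷ blocks≤k
  ; oddLength = oddLength
  ; oddLonger = oddLonger′
  }
  where
  open BlockPartition (pad-partition s P)
  3≤k = partition-3≤k P
  oddLonger′ : ∀ {c} → c < k → ZeroOrOdd (longerThan c (pad (suc s) bs))
  oddLonger′ {c} c<k with c <? 3
  ... | yes c<3 rewrite <ᵇ-true c<3 | longerThan-short blocks≥3 c<3 = inj₂ oddLength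
  ... | no  c≮3 rewrite <ᵇ-false (≮⇒≥ c≮3) = oddLonger c<k

-- The wheel as a graph

-- The vertices of Wheel n are Fin (n + 1): labels 0, …, n − 1 form the rim and n is the hub.
-- Larger labels are clamped to the hub.
vertex : ∀ n → ℕ → Fin (n + 1)
vertex zero    _       = zero
vertex (suc n) zero    = zero
vertex (suc n) (suc j) = suc (vertex n j)

toℕ-vertex : ∀ n {j} → j ≤ n → toℕ (vertex n j) ≡ j
toℕ-vertex zero    {zero}  _       = refl
toℕ-vertex (suc n) {zero}  _       = refl
toℕ-vertex (suc n) {suc j} j+1≤n+1 = cong suc (toℕ-vertex n (s≤s⁻¹ j+1≤n+1))

vertex-toℕ : ∀ n (u : Fin (n + 1)) → vertex n (toℕ u) ≡ u
vertex-toℕ zero    zero    = refl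
vertex-toℕ (suc n) zero    = refl
vertex-toℕ (suc n) (suc u) = cong suc (vertex-toℕ n u)

toℕ≤n : ∀ n (u : Fin (n + 1)) → toℕ u ≤ n
toℕ≤n n u = s≤s⁻¹ (subst (toℕ u <_) (+-comm n 1) (toℕ<n u))

wheelAdj : ℕ → ℕ → ℕ → Bool
wheelAdj n a b = if a <ᵇ n then (if b <ᵇ n then cycleAdj n a b else true) else b <ᵇ n

adj-Wheel : ∀ n (u w : Fin (n + 1)) → adj (Wheel n) u w ≡ wheelAdj n (toℕ u) (toℕ w)
adj-Wheel n u w with toℕ u <? n | toℕ w <? n
... | yes u<n | yes w<n
  rewrite splitAt-< n u u<n | splitAt-< n w w<n | <ᵇ-true u<n | <ᵇ-true w<n
  = cong₂ (cycleAdj n) (toℕ-fromℕ< u<n) (toℕ-fromℕ< w<n)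
... | yes u<n | no w≮n
  rewrite splitAt-< n u u<n | splitAt-≥ n w (≮⇒≥ w≮n) | <ᵇ-true u<n | <ᵇ-false (≮⇒≥ w≮n) = refl
... | no u≮n | yes w<n
  rewrite splitAt-≥ n u (≮⇒≥ u≮n) | splitAt-< n w w<n | <ᵇ-false (≮⇒≥ u≮n) | <ᵇ-true w<n = refl
... | no u≮n | no w≮n
  rewrite splitAt-≥ n u (≮⇒≥ u≮n) | splitAt-≥ n w (≮⇒≥ w≮n) | <ᵇ-false (≮⇒≥ u≮n) | <ᵇ-false (≮⇒≥ w≮n) = refl

wheelAdj-rim : ∀ {n i j} → i < n → j < n → wheelAdj n i j ≡ cycleAdj n i j
wheelAdj-rim i<n j<n rewrite <ᵇ-true i<n | <ᵇ-true j<n = refl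

wheelAdj-rim-hub : ∀ {n i} → i < n → wheelAdj n i n ≡ true
wheelAdj-rim-hub {n} i<n rewrite <ᵇ-true i<n | <ᵇ-false (≤-refl {n}) = refl

wheelAdj-hub-rim : ∀ {n j} → j < n → wheelAdj n n j ≡ true
wheelAdj-hub-rim {n} j<n rewrite <ᵇ-false (≤-refl {n}) | <ᵇ-true j<n = refl

wheelAdj-hub-hub : ∀ n → wheelAdj n n n ≡ false
wheelAdj-hub-hub n rewrite <ᵇ-false (≤-refl {n}) = refl

length-filterᵇ-tabulate : ∀ {A : Set} m (f : Fin m → A) (p : A → Bool) (q : ℕ → Bool) →
                          (∀ x → p (f x) ≡ q (toℕ x)) → length (filterᵇ p (tabulate f)) ≡ ∑[ j < m ] ⟦ q j ⟧
length-filterᵇ-tabulate zero    f p q p≗q = refl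
length-filterᵇ-tabulate (suc m) f p q p≗q with p (f zero) | p≗q zero
... | true  | p≡q rewrite sym p≡q = cong suc (length-filterᵇ-tabulate m (f ∘ suc) p (q ∘ suc) (p≗q ∘ suc))
... | false | p≡q rewrite sym p≡q = length-filterᵇ-tabulate m (f ∘ suc) p (q ∘ suc) (p≗q ∘ suc)

module WheelCounts {n k} (col : Fin (n + 1) → Fin k) where

  colourAt : ℕ → ℕ
  colourAt j = toℕ (col (vertex n j))

  nbrs : ℕ → Fin k → ℕ
  nbrs a c = nbrsWithColour (Wheel n) col (vertex n a) c

  private
    ∑-hub : ∀ (f : ℕ → ℕ) → ∑< (n + 1) f ≡ ∑< n f + f n
    ∑-hub f = trans (cong (λ m → ∑< m f) (+-comm n 1)) (∑-snoc n f)

    nbrs-∑ : ∀ {a} c → a ≤ n → nbrs a c ≡ ∑[ j < n + 1 ] ⟦ wheelAdj n a j ∧ (colourAt j ≡ᵇ toℕ c) ⟧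
    nbrs-∑ {a} c a≤n = length-filterᵇ-tabulate (n + 1) id _ _ λ u →
      cong₂ (λ x v → x ∧ (toℕ (col v) ≡ᵇ toℕ c))
            (trans (adj-Wheel n _ u) (cong (λ x → wheelAdj n x (toℕ u)) (toℕ-vertex n a≤n)))
            (sym (vertex-toℕ n u))

  adjacent : ∀ {a b} → a ≤ n → b ≤ n → T (wheelAdj n a b) → adj (Wheel n) (vertex n a) (vertex n b) ≡ true
  adjacent a≤n b≤n ab = trans (adj-Wheel n _ _) (subst₂ (λ x y → wheelAdj n x y ≡ true)
                          (sym (toℕ-vertex n a≤n)) (sym (toℕ-vertex n b≤n)) (to T-≡ ab))

  nbrs-rim : 3 ≤ n → ∀ {i} c → i < n →
             nbrs i c ≡ ⟦ colourAt (prev n i) ≡ᵇ toℕ c ⟧ + ⟦ colourAt (next n i) ≡ᵇ toℕ c ⟧ + ⟦ colourAt n ≡ᵇ toℕ c ⟧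
  nbrs-rim 3≤n {i} c i<n = begin
    nbrs i c                                ≡⟨ nbrs-∑ c (<⇒≤ i<n) ⟩
    ∑[ j < n + 1 ] ⟦ wheelAdj n i j ∧ P j ⟧ ≡⟨ ∑-hub _ ⟩
    ∑[ j < n ] ⟦ wheelAdj n i j ∧ P j ⟧ + ⟦ wheelAdj n i n ∧ P n ⟧
      ≡⟨ cong₂ _+_ (∑-cong n (λ j<n → cong (λ x → ⟦ x ∧ P _ ⟧) (wheelAdj-rim i<n j<n)))
                   (cong (λ x → ⟦ x ∧ P n ⟧) (wheelAdj-rim-hub i<n)) ⟩
    ∑[ j < n ] ⟦ cycleAdj n i j ∧ P j ⟧ + ⟦ P n ⟧
      ≡⟨ cong (_+ ⟦ P n ⟧) (∑-pair n _ (prev<n i<n) (next<n i<n) (prev≢next 3≤n i<n) non-neighbour) ⟩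
    ⟦ cycleAdj n i (prev n i) ∧ P (prev n i) ⟧ + ⟦ cycleAdj n i (next n i) ∧ P (next n i) ⟧ + ⟦ P n ⟧
      ≡⟨ cong₂ (λ x y → x + y + ⟦ P n ⟧) (⟦T∧⟧ _ (cycleAdj-prev i<n)) (⟦T∧⟧ _ (cycleAdj-next i<n)) ⟩
    ⟦ P (prev n i) ⟧ + ⟦ P (next n i) ⟧ + ⟦ P n ⟧  ∎
    where
    open ≡-Reasoning
    P : ℕ → Bool
    P j = colourAt j ≡ᵇ toℕ c
    non-neighbour : ∀ {j} → j < n → j ≢ prev n i → j ≢ next n i → ⟦ cycleAdj n i j ∧ P j ⟧ ≡ 0
    non-neighbour {j} j<n j≢prev j≢next with cycleAdj n i j in ij
    ... | false = refl
    ... | true with cycleAdj⇒ j<n (from T-≡ ij)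
    ...   | inj₁ j≡next = ⊥-elim (j≢next j≡next)
    ...   | inj₂ j≡prev = ⊥-elim (j≢prev j≡prev)

  nbrs-hub : ∀ c → nbrs n c ≡ classSize n colourAt (toℕ c)
  nbrs-hub c = begin
    nbrs n c                                ≡⟨ nbrs-∑ c ≤-refl ⟩
    ∑[ j < n + 1 ] ⟦ wheelAdj n n j ∧ P j ⟧ ≡⟨ ∑-hub _ ⟩
    ∑[ j < n ] ⟦ wheelAdj n n j ∧ P j ⟧ + ⟦ wheelAdj n n n ∧ P n ⟧
      ≡⟨ cong₂ _+_ (∑-cong n (λ j<n → cong (λ x → ⟦ x ∧ P _ ⟧) (wheelAdj-hub-rim j<n)))
                   (⟦false∧⟧ (P n) (wheelAdj-hub-hub n)) ⟩
    classSize n colourAt (toℕ c) + 0        ≡⟨ +-identityʳ _ ⟩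
    classSize n colourAt (toℕ c)            ∎
    where
    open ≡-Reasoning
    P : ℕ → Bool
    P j = colourAt j ≡ᵇ toℕ c

colouring⇒rimColouring : ∀ {n k} → 3 ≤ n → StrongOddColourable (Wheel n) k →
                         Σ (ℕ → ℕ) λ F → RimColouring n k F × usedColours n k F < k
colouring⇒rimColouring {n} {k} 3≤n (col , proper-col , odd-col) = colourAt , rim , used<k
  where
  open WheelCounts col

  adjacent⇒≢ : ∀ {a b} → a ≤ n → b ≤ n → T (wheelAdj n a b) → colourAt a ≢ colourAt b
  adjacent⇒≢ a≤n b≤n ab = proper-col _ _ (adjacent a≤n b≤n ab) ∘ toℕ-injective

  rim≢hub : ∀ {i} → i < n → colourAt i ≢ colourAt n
  rim≢hub i<n = adjacent⇒≢ (<⇒≤ i<n) ≤-refl (from T-≡ (wheelAdj-rim-hub i<n))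

  proper : ∀ {i} → i < n → colourAt i ≢ colourAt (next n i)
  proper i<n = adjacent⇒≢ (<⇒≤ i<n) (<⇒≤ (next<n i<n))
                 (subst T (sym (wheelAdj-rim i<n (next<n i<n))) (cycleAdj-next i<n))

  -- Otherwise rim vertex i sees the colour of next n i exactly twice.
  proper² : ∀ {i} → i < n → colourAt (prev n i) ≢ colourAt (next n i)
  proper² {i} i<n same with odd-col (vertex n i) c | nbrs-rim 3≤n c i<n
    where c = col (vertex n (next n i))
  ... | odd | nbrs≡ rewrite same | ⟦≡ᵇ⟧-refl (colourAt (next n i))
                           | ⟦≡ᵇ⟧-≢ (rim≢hub (next<n i<n) ∘ sym) | nbrs≡ with odd
  ...   | inj₁ ()
  ...   | inj₂ ()

  oddClasses : ∀ {c} → c < k → ZeroOrOdd (classSize n colourAt c)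
  oddClasses c<k = subst ZeroOrOdd (trans (nbrs-hub (fromℕ< c<k)) (cong (classSize n colourAt) (toℕ-fromℕ< c<k)))
                        (odd-col (vertex n n) (fromℕ< c<k))

  rim : RimColouring n k colourAt
  rim = record { bounded = λ _ → toℕ<n _ ; proper = proper ; proper² = proper² ; oddClasses = oddClasses }

  hub-unused : ⟦ 0 <ᵇ classSize n colourAt (colourAt n) ⟧ < 1
  hub-unused rewrite ∑-zero n (λ i<n → ⟦≡ᵇ⟧-≢ (rim≢hub i<n)) = z<s

  used<k : usedColours n k colourAt < k
  used<k = subst (usedColours n k colourAt <_) (∑-one k)
                 (∑-mono-< k (λ _ → ⟦⟧≤1 _) (toℕ<n (col (vertex n n))) hub-unused)

module HubColour {n k F} (3≤n : 3 ≤ n) (R : RimColouring n k F) where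
  open RimColouring R

  G : ℕ → ℕ
  G j = if j <ᵇ n then F j else k

  G<1+k : ∀ j → G j < suc k
  G<1+k j with j <ᵇ n | <ᵇ-reflects-< j n
  ... | true  | ofʸ j<n = m<n⇒m<1+n (bounded j<n)
  ... | false | _        = n<1+n k

  col : Fin (n + 1) → Fin (suc k)
  col u = fromℕ< (G<1+k (toℕ u))

  open WheelCounts col

  toℕ-col : ∀ u → toℕ (col u) ≡ G (toℕ u)
  toℕ-col u = toℕ-fromℕ< (G<1+k (toℕ u))

  colourAt-rim : ∀ {j} → j < n → colourAt j ≡ F j
  colourAt-rim {j} j<n rewrite toℕ-col (vertex n j) | toℕ-vertex n (<⇒≤ j<n) | <ᵇ-true j<n = refl

  colourAt-hub : colourAt n ≡ k
  colourAt-hub rewrite toℕ-col (vertex n n) | toℕ-vertex n (≤-refl {n}) | <ᵇ-false (≤-refl {n}) = refl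

  adjacent⇒≢ : ∀ {a b} → a ≤ n → b ≤ n → T (wheelAdj n a b) → colourAt a ≢ colourAt b
  adjacent⇒≢ a≤n b≤n ab with m≤n⇒m<n∨m≡n a≤n | m≤n⇒m<n∨m≡n b≤n
  ... | inj₁ a<n | inj₁ b<n rewrite colourAt-rim a<n | colourAt-rim b<n =
    cycle-neighbours-≢ R a<n b<n (subst T (wheelAdj-rim a<n b<n) ab)
  ... | inj₁ a<n | inj₂ refl rewrite colourAt-rim a<n | colourAt-hub = <⇒≢ (bounded a<n)
  ... | inj₂ refl | inj₁ b<n rewrite colourAt-rim b<n | colourAt-hub = <⇒≢ (bounded b<n) ∘ sym
  ... | inj₂ refl | inj₂ refl rewrite wheelAdj-hub-hub n with ab
  ...   | ()

  proper-col : ∀ u w → adj (Wheel n) u w ≡ true → col u ≢ col w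
  proper-col u w uw same =
    adjacent⇒≢ (toℕ≤n n u) (toℕ≤n n w) (from T-≡ (trans (sym (adj-Wheel n u w)) uw))
      (subst₂ (λ x y → toℕ (col x) ≡ toℕ (col y)) (sym (vertex-toℕ n u)) (sym (vertex-toℕ n w)) (cong toℕ same))

  odd-at : ∀ {a} c → a ≤ n → ZeroOrOdd (nbrsWithColour (Wheel n) col (vertex n a) c)
  odd-at c a≤n with m≤n⇒m<n∨m≡n a≤n
  ... | inj₁ a<n rewrite nbrs-rim 3≤n c a<n | colourAt-rim (prev<n a<n) | colourAt-rim (next<n a<n) | colourAt-hub =
    ≤1⇒zeroOrOdd (⟦≡ᵇ⟧-distinct₃ (toℕ c) (proper² a<n) (<⇒≢ (bounded (next<n a<n))) (<⇒≢ (bounded (prev<n a<n))))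
  ... | inj₂ refl rewrite nbrs-hub c | ∑-cong n (cong (λ x → ⟦ x ≡ᵇ toℕ c ⟧) ∘ colourAt-rim)
    with m≤n⇒m<n∨m≡n (s≤s⁻¹ (toℕ<n c))
  ...   | inj₁ c<k  = oddClasses c<k
  ...   | inj₂ c≡k = inj₁ (unused-beyond R (≤-reflexive (sym c≡k)))

  odd-col : ∀ v c → ZeroOrOdd (nbrsWithColour (Wheel n) col v c)
  odd-col v c = subst (λ u → ZeroOrOdd (nbrsWithColour (Wheel n) col u c)) (vertex-toℕ n v) (odd-at c (toℕ≤n n v))

rimColouring⇒colouring : ∀ {n k F} → 3 ≤ n → RimColouring n k F → StrongOddColourable (Wheel n) (suc k)
rimColouring⇒colouring 3≤n R = col , proper-col , odd-col
  where open HubColour 3≤n R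

χso-Wheel : ∀ {n k} → 3 ≤ n → StrongOddColourable (Wheel n) (suc k) →
            (∀ {j F} → RimColouring n j F → k ≤ usedColours n j F) → StrongOddChromaticNumber (Wheel n) (suc k)
χso-Wheel 3≤n colourable k≤used = colourable , λ j j<1+k colouring →
  let (_ , R , used<j) = colouring⇒rimColouring 3≤n colouring
  in <⇒≱ (≤-<-trans (k≤used R) used<j) (s≤s⁻¹ j<1+k)

-- Colourings of wheels

blocksColourable : ∀ {k bs} → BlockPartition k bs → StrongOddColourable (Wheel (sum bs)) (suc k)
blocksColourable {bs = []} P with BlockPartition.oddLength P
... | ()
blocksColourable {bs = b ∷ bs} P with BlockPartition.blocks≥3 P
... | 3≤b ∷ _ = rimColouring⇒colouring (≤-trans 3≤b (m≤m+n b (sum bs))) (blockRimColouring P)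

paddedColourable : ∀ s {k bs} → BlockPartition k bs → StrongOddColourable (Wheel (sum bs + s * 6)) (suc k)
paddedColourable s {bs = bs} P =
  subst (λ n → StrongOddColourable (Wheel n) _) (sum-pad s bs) (blocksColourable (pad-partition s P))

colourable-3mod6 : ∀ {n} r q → n ≡ r + q * 6 → r ≡ 3 → StrongOddColourable (Wheel n) 4
colourable-3mod6 _ q refl refl = paddedColourable q (decidePartition 3 (3 ∷ []))

colourable-even : ∀ {n} r q → n ≡ r + q * 6 → r ≡ 0 ⊎ r ≡ 2 ⊎ r ≡ 4 → 8 < n → n ≢ 14 →
                  StrongOddColourable (Wheel n) 5
colourable-even _ (suc (suc s)) refl (inj₁ refl) _ _ =
  paddedColourable s (decidePartition 4 (4 ∷ 4 ∷ 4 ∷ []))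
colourable-even _ (suc (suc (suc s))) refl (inj₂ (inj₁ refl)) _ _ =
  paddedColourable s (decidePartition 4 (4 ∷ 4 ∷ 4 ∷ 4 ∷ 4 ∷ []))
colourable-even _ (suc s) refl (inj₂ (inj₂ refl)) _ _ =
  paddedColourable s (decidePartition 4 (4 ∷ 3 ∷ 3 ∷ []))
colourable-even _ 2 refl (inj₂ (inj₁ refl)) _ n≢14 = ⊥-elim (n≢14 refl)
colourable-even _ 0 refl (inj₁ refl)        8<0 _ = ⊥-elim (from-no (8 <? 0) 8<0)
colourable-even _ 1 refl (inj₁ refl)        8<6 _ = ⊥-elim (from-no (8 <? 6) 8<6)
colourable-even _ 0 refl (inj₂ (inj₁ refl)) 8<2 _ = ⊥-elim (from-no (8 <? 2) 8<2)
colourable-even _ 1 refl (inj₂ (inj₁ refl)) 8<8 _ = ⊥-elim (from-no (8 <? 8) 8<8)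
colourable-even _ 0 refl (inj₂ (inj₂ refl)) 8<4 _ = ⊥-elim (from-no (8 <? 4) 8<4)

colourable-odd : ∀ {n} r q → n ≡ r + q * 6 → r ≡ 1 ⊎ r ≡ 5 → 8 < n → StrongOddColourable (Wheel n) 6
colourable-odd _ (suc (suc s)) refl (inj₁ refl) _ = paddedColourable s (decidePartition 5 (5 ∷ 4 ∷ 4 ∷ []))
colourable-odd _ (suc s)       refl (inj₂ refl) _ = paddedColourable s (decidePartition 5 (5 ∷ 3 ∷ 3 ∷ []))
colourable-odd _ 0 refl (inj₁ refl) 8<1 = ⊥-elim (from-no (8 <? 1) 8<1)
colourable-odd _ 1 refl (inj₁ refl) 8<7 = ⊥-elim (from-no (8 <? 7) 8<7)
colourable-odd _ 0 refl (inj₂ refl) 8<5 = ⊥-elim (from-no (8 <? 5) 8<5)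

colourable-14 : StrongOddColourable (Wheel 14) 7
colourable-14 = blocksColourable (decidePartition 6 (6 ∷ 4 ∷ 4 ∷ []))

colourable-small : ∀ {n} → 3 ≤ n → StrongOddColourable (Wheel n) (suc n)
colourable-small {n} 3≤n = subst (λ m → StrongOddColourable (Wheel m) (suc n)) (+-identityʳ n) (blocksColourable single)
  where
  single : BlockPartition n (n ∷ [])
  single = record
    { blocks≥3  = 3≤n ∷ []
    ; blocks≤k  = ≤-refl ∷ []
    ; oddLength = refl
    ; oddLonger = λ c<n → inj₂ (subst (λ b → Odd (⟦ b ⟧ + 0)) (sym (<ᵇ-true c<n)) refl)
    }

%6⇒% : ∀ n {r} d .{{_ : NonZero d}} → d ∣ 6 → n % 6 ≡ r → n % d ≡ r % d
%6⇒% n d d∣6 n%6≡r = trans (sym (m∣n⇒o%n%m≡o%m d 6 n d∣6)) (cong (_% d) n%6≡r)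

even-residue : ∀ n → n % 6 ≡ 0 ⊎ n % 6 ≡ 2 ⊎ n % 6 ≡ 4 → n % 2 ≡ 0
even-residue n (inj₁ r≡0)        = %6⇒% n 2 (divides 3 refl) r≡0
even-residue n (inj₂ (inj₁ r≡2)) = %6⇒% n 2 (divides 3 refl) r≡2
even-residue n (inj₂ (inj₂ r≡4)) = %6⇒% n 2 (divides 3 refl) r≡4

odd-residue : ∀ n → n % 6 ≡ 1 ⊎ n % 6 ≡ 5 → n % 2 ≡ 1
odd-residue n (inj₁ r≡1) = %6⇒% n 2 (divides 3 refl) r≡1
odd-residue n (inj₂ r≡5) = %6⇒% n 2 (divides 3 refl) r≡5

odd-residue-3∤ : ∀ n → n % 6 ≡ 1 ⊎ n % 6 ≡ 5 → n % 3 ≢ 0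
odd-residue-3∤ n (inj₁ r≡1) = 1+n≢0 ∘ trans (sym (%6⇒% n 3 (divides 2 refl) r≡1))
odd-residue-3∤ n (inj₂ r≡5) = 1+n≢0 ∘ trans (sym (%6⇒% n 3 (divides 2 refl) r≡5))

open UsedColours using (3≤used; even⇒4≤used; odd⇒5≤used; 14⇒6≤used; ≤8⇒n≤used)

theorem1 : (n : ℕ) → 3 ≤ n →
    (n % 6 ≡ 3 → StrongOddChromaticNumber (Wheel n) 4)
    × ((n % 6 ≡ 0 ⊎ n % 6 ≡ 2 ⊎ n % 6 ≡ 4) → 8 < n → n ≢ 14 → StrongOddChromaticNumber (Wheel n) 5)
    × ((n % 6 ≡ 1 ⊎ n % 6 ≡ 5) → 8 < n → StrongOddChromaticNumber (Wheel n) 6)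
    × (n ≡ 14 → StrongOddChromaticNumber (Wheel n) 7)
    × (n ≤ 8 → StrongOddChromaticNumber (Wheel n) (suc n))
theorem1 n 3≤n =
    (λ r≡3 → χso-Wheel 3≤n (colourable-3mod6 r q n≡r+q*6 r≡3) (3≤used 3≤n))
  , (λ r∈024 8<n n≢14 → χso-Wheel 3≤n (colourable-even r q n≡r+q*6 r∈024 8<n n≢14)
                                      (λ R → even⇒4≤used 3≤n R (even-residue n r∈024)))
  , (λ r∈15 8<n → χso-Wheel 3≤n (colourable-odd r q n≡r+q*6 r∈15 8<n)
                                (λ R → odd⇒5≤used 3≤n R (odd-residue n r∈15) (odd-residue-3∤ n r∈15)))
  , (λ n≡14 → χso-Wheel 3≤n (subst (λ m → StrongOddColourable (Wheel m) 7) (sym n≡14) colourable-14)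
                            (λ R → 14⇒6≤used 3≤n R n≡14))
  , (λ n≤8 → χso-Wheel 3≤n (colourable-small 3≤n) (λ R → ≤8⇒n≤used 3≤n R n≤8))
  where
  r = n % 6
  q = n / 6
  n≡r+q*6 : n ≡ r + q * 6
  n≡r+q*6 = m≡m%n+[m/n]*n n 6
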